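{- Let $G$ be a $P_9$-free chordal graph, let $C_1,\dots,C_\ell$ be its irredundant components, let $A\in\mathcal{D}_{RN}(G)$ and let $I\subseteq IR(G)$. Then $A\cup I$ is a minimal dominating set of $G$ (i.e. $I$ is an irredundant extension of $A$) if and only if, for every $i\in\{1,\dots,\ell\}$, the set $D_i=I\cap C_i$ is inclusion-minimal among the subsets $D\subseteq C_i$ such that (1) $D$ dominates $C_i\setminus N(A)$, and (2) $D$ does not dominate $Priv_{IR}(A,x)$ for any $x\in R_i(A)$.
   Context: All graphs are finite, simple and undirected. $N(x)$, $N[x]=N(x)\cup\{x\}$ are the open and closed neighbourhoods of $x$; for $X\subseteq V(G)$, $N[X]=\bigcup_{x\in X}N[x]$ and $N(X)=N[X]\setminus X$. A set $D$ dominates $X$ if $X\subseteq N[D]$; a minimal dominating set of $G$ is an inclusion-minimal set dominating $V(G)$. A vertex $x$ is irredundant if $N[x]$ is inclusion-minimal in $\{N[y]:y\in V(G)\}$, with the convention that among several vertices having the same inclusion-minimal closed neighbourhood exactly one (fixed) is declared irredundant; all other vertices are redundant. $IR(G)$, $RN(G)$ are the sets of irredundant and redundant vertices; an irredundant component is the vertex set of a connected component of $G[IR(G)]$. For $D\subseteq V(G)$ and $x\in D$, a private neighbour of $x$ w.r.t. $D$ is a vertex $u$ with $N[u]\cap D=\{x\}$ (possibly $u=x$); $Priv_{IR}(D,x)$ is the set of private neighbours of $x$ w.r.t. $D$ that lie in $IR(G)$. $\mathcal{D}_{RN}(G)=\{D\cap RN(G): D\text{ a minimal dominating set of }G\}$.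 For $A\subseteq RN(G)$: $B(A)$ is the set of $a\in A$ having an element of $Priv_{IR}(A,a)$ in some irredundant component $C$ with $C\subseteq N(A)$; $R(A)=A\setminus B(A)$; and $R_i(A)$ is the set of $x\in R(A)$ having at least one private neighbour w.r.t. $A$ in $C_i$. $P_k$-free means no induced path on $k$ vertices; chordal means no induced cycle of length at least four. -}

module Defs where

open import Data.Nat using (ℕ; zero; suc; _≤_; _∸_)
open import Data.Fin using (Fin; toℕ)
open import Data.Fin.Subset using (Subset; _∈_; _∉_; _⊆_; _∪_; _∩_)
open import Data.Bool using (Bool; true; false)
open import Data.Product using (Σ; ∃; ∃-syntax; _×_; _,_)
open import Data.Sum using (_⊎_)
open import Data.Empty using (⊥)
open import Relation.Nullary using (¬_)
open import Relation.Binary.PropositionalEquality using (_≡_; _≢_)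
open import Function.Base using (_∘_)
open import Function.Bundles using (_⇔_)

record Graph (n : ℕ) : Set where
  field
    adj     : Fin n → Fin n → Bool
    adj-sym : ∀ x y → adj x y ≡ adj y x
    irrefl  : ∀ x → adj x x ≡ false

module _ {n : ℕ} (G : Graph n) where
  open Graph G

  Adj : Fin n → Fin n → Set
  Adj x y = adj x y ≡ true

  CAdj : Fin n → Fin n → Set
  CAdj x y = (x ≡ y) ⊎ Adj x y

  InNc : Subset n → Fin n → Set
  InNc X y = ∃[ x ] (x ∈ X × CAdj x y)

  InNo : Subset n → Fin n → Set
  InNo X y = InNc X y × y ∉ X

  Dominates : Subset n → (Fin n → Set) → Set
  Dominates D X = ∀ y → X y → InNc D y

  Everything : Fin n → Set
  Everything _ = Fin n

  MinDom : Subset n → Set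
  MinDom D = Dominates D Everything
           × (∀ D′ → D′ ⊆ D → Dominates D′ Everything → D ⊆ D′)

  NcSub : Fin n → Fin n → Set
  NcSub x y = ∀ z → CAdj x z → CAdj y z

  NcMinimal : Fin n → Set
  NcMinimal x = ∀ y → NcSub y x → NcSub x y

  -- irr is a valid choice of the irredundant vertices: every chosen vertex
  -- has inclusion-minimal closed neighbourhood, every inclusion-minimal
  -- closed neighbourhood is realised by a chosen vertex, and exactly one
  -- vertex is chosen per such closed neighbourhood.
  record IsIRChoice (irr : Subset n) : Set where
    field
      chosen-minimal : ∀ x → x ∈ irr → NcMinimal x
      chosen-exists  : ∀ x → NcMinimal x →
                       ∃[ y ] (y ∈ irr × NcSub x y × NcSub y x)
      chosen-unique  : ∀ x y → x ∈ irr → y ∈ irr →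
                       NcSub x y → NcSub y x → x ≡ y

  IsInducedPath : (k : ℕ) → (Fin k → Fin n) → Set
  IsInducedPath k f =
    (∀ i j → f i ≡ f j → i ≡ j) ×
    (∀ i j → Adj (f i) (f j) ⇔ ((toℕ j ≡ suc (toℕ i)) ⊎ (toℕ i ≡ suc (toℕ j))))

  PFree : ℕ → Set
  PFree k = ∀ (f : Fin k → Fin n) → ¬ IsInducedPath k f

  CycNext : (m : ℕ) → Fin m → Fin m → Set
  CycNext m i j = (toℕ j ≡ suc (toℕ i)) ⊎ ((toℕ i ≡ m ∸ 1) × (toℕ j ≡ 0))

  IsInducedCycle : (m : ℕ) → (Fin m → Fin n) → Set
  IsInducedCycle m f =
    (∀ i j → f i ≡ f j → i ≡ j) ×
    (∀ i j → Adj (f i) (f j) ⇔ (CycNext m i j ⊎ CycNext m j i))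

  Chordal : Set
  Chordal = ∀ (m : ℕ) → 4 ≤ m → (f : Fin m → Fin n) → ¬ IsInducedCycle m f

  data Reach (S : Subset n) (x : Fin n) : Fin n → Set where
    here : x ∈ S → Reach S x x
    step : ∀ {y z} → Reach S x y → z ∈ S → Adj y z → Reach S x z

  record IsIRComponent (irr C : Subset n) : Set where
    field
      nonempty  : ∃[ x ] (x ∈ C)
      inside    : C ⊆ irr
      connected : ∀ x y → x ∈ C → y ∈ C → Reach C x y
      closed    : ∀ x y → x ∈ C → y ∈ irr → Adj x y → y ∈ C

  Priv : Subset n → Fin n → Fin n → Set
  Priv D x u = x ∈ D × CAdj x u × (∀ y → y ∈ D → CAdj y u → y ≡ x)

  PrivIR : Subset n → Subset n → Fin n → Fin n → Set
  PrivIR irr D x u = Priv D x u × u ∈ irr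

  InDRN : Subset n → Subset n → Set
  InDRN irr A = ∃[ D ] (MinDom D × (∀ x → (x ∈ A ⇔ (x ∈ D × x ∉ irr))))

  InB : Subset n → Subset n → Fin n → Set
  InB irr A a = a ∈ A × ∃[ u ] (PrivIR irr A a u ×
                  ∃[ C ] (IsIRComponent irr C × u ∈ C × (∀ v → v ∈ C → InNo A v)))

  InR : Subset n → Subset n → Fin n → Set
  InR irr A x = x ∈ A × ¬ InB irr A x

  InRC : Subset n → Subset n → Subset n → Fin n → Set
  InRC irr A C x = InR irr A x × ∃[ u ] (Priv A x u × u ∈ C)

  Cond : Subset n → Subset n → Subset n → Subset n → Set
  Cond irr A C D =
    D ⊆ C ×
    Dominates D (λ y → y ∈ C × ¬ InNo A y) ×
    (∀ x → InRC irr A C x → ¬ Dominates D (PrivIR irr A x))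

  MinCond : Subset n → Subset n → Subset n → Subset n → Set
  MinCond irr A C D = Cond irr A C D × (∀ D′ → D′ ⊆ D → Cond irr A C D′ → D ⊆ D′)

module Submission where

-- Forward direction: if A ∪ I is a minimal dominating set, every element of
-- I ∩ C has an irredundant private neighbour in C ∖ N(A), and every x ∈ A keeps
-- an irredundant private neighbour that I cannot dominate; this gives (1), (2)
-- and minimality of I ∩ C.  Backward direction: (1) makes A ∪ I dominating,
-- minimality of I ∩ C gives every z ∈ I a private neighbour, and for z ∈ A we
-- use the key structural lemma: a vertex of R(A) has all its irredundant
-- private neighbours in a single irredundant component.  Otherwise z would send
-- an induced arm on five vertices into each of two components; in a chordal
-- graph two such arms glue into an induced P₉.

open import Defs
open import Data.Nat using (ℕ; suc; _∸_; _<_; z≤n; s≤s) renaming (_≟_ to _≟ⁿ_)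
open import Data.Nat.Properties using (<-cmp; suc-injective; <-asym; ≤-reflexive; 1+n≢n; n≮0)
open import Data.Fin using (Fin; toℕ) renaming (zero to fzero; suc to fsuc; _≟_ to _≟ᶠ_)
open import Data.Fin.Properties using (toℕ-injective; any?; all?; ¬∀⟶∃¬)
open import Data.Fin.Subset
  using (Subset; _∈_; _∉_; _⊆_; _⊂_; _⊃_; _∪_; _∩_; _-_; ⁅_⁆) renaming (⊥ to ∅)
open import Data.Fin.Subset.Properties
  using (_∈?_; x∈p∪q⁻; x∈p∪q⁺; x∈p∩q⁻; x∈p∩q⁺; x∈⁅x⁆; x∈⁅y⁆⇒x≡y; ∉⊥;
         x∈p⇒p-x⊂p; x∈p∧x≢y⇒x∈p-y; p⊆p∪q)
open import Data.Fin.Subset.Induction using (⊂-wellFounded; ⊃-wellFounded)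
open import Data.Bool using (true)
open import Data.Bool.Properties using () renaming (_≟_ to _≟ᵇ_)
open import Data.Vec using (tabulate)
open import Data.Vec.Properties using (lookup∘tabulate; []=⇒lookup; lookup⇒[]=)
open import Data.List using (List; []; _∷_; length; lookup; _ʳ++_)
open import Data.List.Relation.Unary.All using (All; []; _∷_) renaming (lookup to All-lookup)
open import Data.List.Relation.Unary.First using (First; [_]; _∷_)
open import Data.List.Membership.Propositional.Properties using (∈-lookup)
open import Data.Unit using (⊤; tt)
open import Data.Product using (∃; ∃-syntax; _×_; _,_; proj₁; proj₂)
open import Data.Sum using (_⊎_; inj₁; inj₂; [_,_]′; swap) renaming (map to ⊎-map)
open import Data.Empty using (⊥-elim) renaming (⊥ to Empty)
open import Relation.Nullary using (¬_; Dec; yes; no; does)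
open import Relation.Nullary.Decidable using (_×-dec_; _⊎-dec_; _→-dec_; ¬?; dec-true)
open import Relation.Binary.PropositionalEquality using (_≡_; _≢_; refl; sym; trans; cong; subst)
open import Induction.WellFounded using (Acc; acc)
open import Function.Base using (_∘_)
open import Relation.Binary.Definitions using (tri<; tri≈; tri>)
open import Function.Bundles using (_⇔_; mk⇔; Equivalence)

inclusion? : ∀ {n} {P Q : Fin n → Set} → (∀ x → Dec (P x)) → (∀ x → Dec (Q x)) →
             (∀ x → P x → Q x) ⊎ ∃[ x ] (P x × ¬ Q x)
inclusion? {n} P? Q? with all? (λ x → P? x →-dec Q? x)
... | yes P⊆Q = inj₁ P⊆Q
... | no P⊈Q with ¬∀⟶∃¬ n _ (λ x → P? x →-dec Q? x) P⊈Q
...   | x , fails with P? x | Q? x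
...     | yes p | no ¬q = inj₂ (x , p , ¬q)
...     | no ¬p | _     = ⊥-elim (fails (λ p → ⊥-elim (¬p p)))
...     | yes _ | yes q = ⊥-elim (fails (λ _ → q))

minimal-without : ∀ {n} {Good : Subset n → Set} {D : Subset n} {z : Fin n} →
                  (∀ D′ → D′ ⊆ D → Good D′ → D ⊆ D′) → z ∈ D → ¬ Good (D - z)
minimal-without {D = D} {z} minimal z∈D good with x∈p⇒p-x⊂p z∈D
... | D-z⊆D , y , y∈D , y∉D-z = y∉D-z (minimal (D - z) D-z⊆D good y∈D)

∪ˡ : ∀ {n} {p q : Subset n} {x} → x ∈ p → x ∈ p ∪ q
∪ˡ x∈p = x∈p∪q⁺ (inj₁ x∈p)

∪ʳ : ∀ {n} {p q : Subset n} {x} → x ∈ q → x ∈ p ∪ q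
∪ʳ x∈q = x∈p∪q⁺ (inj₂ x∈q)

∩ˡ : ∀ {n} {p q : Subset n} {x} → x ∈ p ∩ q → x ∈ p
∩ˡ {p = p} {q} x∈ = proj₁ (x∈p∩q⁻ p q x∈)

∩ʳ : ∀ {n} {p q : Subset n} {x} → x ∈ p ∩ q → x ∈ q
∩ʳ {p = p} {q} x∈ = proj₂ (x∈p∩q⁻ p q x∈)

module Graphs {n : ℕ} (G : Graph n) where
  open Graph G

  V : Set
  V = Fin n

  NC : V → V → Set
  NC x y = ¬ CAdj G x y

  Adj? : ∀ x y → Dec (Adj G x y)
  Adj? x y = adj x y ≟ᵇ true

  CAdj? : ∀ x y → Dec (CAdj G x y)
  CAdj? x y = (x ≟ᶠ y) ⊎-dec Adj? x y

  Adj-sym : ∀ {x y} → Adj G x y → Adj G y x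
  Adj-sym {x} {y} xy = trans (adj-sym y x) xy

  Adj⇒≢ : ∀ {x y} → Adj G x y → x ≢ y
  Adj⇒≢ {x} xx refl with trans (sym (irrefl x)) xx
  ... | ()

  CAdj-sym : ∀ {x y} → CAdj G x y → CAdj G y x
  CAdj-sym (inj₁ x≡y) = inj₁ (sym x≡y)
  CAdj-sym (inj₂ xy)  = inj₂ (Adj-sym xy)

  NC-sym : ∀ {x y} → NC x y → NC y x
  NC-sym x≁y = x≁y ∘ CAdj-sym

  CAdj-≢ : ∀ {x y} → CAdj G x y → x ≢ y → Adj G x y
  CAdj-≢ (inj₁ x≡y) x≢y = ⊥-elim (x≢y x≡y)
  CAdj-≢ (inj₂ xy)  _   = xy

  CAdj-away : ∀ {a b c} → Adj G a b → CAdj G b c → NC a c → Adj G b c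
  CAdj-away ab bc a≁c = CAdj-≢ bc λ { refl → a≁c (inj₂ ab) }

  InNc? : ∀ X y → Dec (InNc G X y)
  InNc? X y = any? (λ x → (x ∈? X) ×-dec CAdj? x y)

  InNo? : ∀ X y → Dec (InNo G X y)
  InNo? X y = InNc? X y ×-dec ¬? (y ∈? X)

  NcSub? : ∀ x y → Dec (NcSub G x y)
  NcSub? x y = all? (λ z → CAdj? x z →-dec CAdj? y z)

  Priv? : ∀ D x u → Dec (Priv G D x u)
  Priv? D x u = (x ∈? D) ×-dec CAdj? x u ×-dec all? (λ y → (y ∈? D) →-dec CAdj? y u →-dec (y ≟ᶠ x))

  InNc-mono : ∀ {X Y y} → X ⊆ Y → InNc G X y → InNc G Y y
  InNc-mono X⊆Y (x , x∈X , xy) = x , X⊆Y x∈X , xy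

  reach-end : ∀ {S a b} → Reach G S a b → b ∈ S
  reach-end (here b∈S)     = b∈S
  reach-end (step _ b∈S _) = b∈S

  reach-trans : ∀ {S a b c} → Reach G S a b → Reach G S b c → Reach G S a c
  reach-trans r (here _)         = r
  reach-trans r (step r′ c∈S bc) = step (reach-trans r r′) c∈S bc

  reach-rev : ∀ {S a b} → Reach G S a b → Reach G S b a
  reach-rev (here a∈S)         = here a∈S
  reach-rev (step r b∈S yb) = reach-trans (step (here b∈S) (reach-end r) (Adj-sym yb)) (reach-rev r)

  leave : ∀ {S x u y} → x ∉ S → Reach G S u y → Adj G x u → NC x y →
          ∃[ b ] ∃[ c ] (b ∈ S × c ∈ S × Adj G x b × Adj G b c × NC x c)
  leave x∉S (here _) xu x≁u = ⊥-elim (x≁u (inj₂ xu))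
  leave {x = x} x∉S (step {b} r c∈S bc) xu x≁c with CAdj? x b
  ... | no x≁b          = leave x∉S r xu x≁b
  ... | yes (inj₁ refl) = ⊥-elim (x∉S (reach-end r))
  ... | yes (inj₂ xb)   = b , _ , reach-end r , c∈S , xb , bc , x≁c

module Domination {n : ℕ} (G : Graph n) where
  open Graphs G

  Priv-restrict : ∀ {X Y z u} → X ⊆ Y → z ∈ X → Priv G Y z u → Priv G X z u
  Priv-restrict X⊆Y z∈X (_ , zu , only) = z∈X , zu , λ y y∈X → only y (X⊆Y y∈X)

  sole-neighbour : ∀ {D z y e} → ¬ InNc G (D - z) y → e ∈ D → CAdj G e y → e ≡ z
  sole-neighbour {z = z} {e = e} undominated e∈D ey with e ≟ᶠ z
  ... | yes e≡z = e≡z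
  ... | no e≢z  = ⊥-elim (undominated (e , x∈p∧x≢y⇒x∈p-y e∈D e≢z , ey))

  Dom : Subset n → Set
  Dom D = Dominates G D (Everything G)

  has-private : ∀ {D z} → MinDom G D → z ∈ D → ∃[ u ] Priv G D z u
  has-private {D} {z} (dom , minimal) z∈D with inclusion? (λ y → yes y) (InNc? (D - z))
  ... | inj₁ still-dom = ⊥-elim (minimal-without minimal z∈D still-dom)
  ... | inj₂ (y , _ , undominated) with dom y y
  ...   | d , d∈D , dy =
    y , z∈D , subst (λ t → CAdj G t y) (sole-neighbour undominated d∈D dy) dy ,
    λ e e∈D ey → sole-neighbour undominated e∈D ey

  from-private : ∀ D → Dom D → (∀ z → z ∈ D → ∃[ u ] Priv G D z u) → MinDom G D
  from-private D dom privates = dom , minimal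
    where
      minimal : ∀ D′ → D′ ⊆ D → Dom D′ → D ⊆ D′
      minimal D′ D′⊆D dom′ {z} z∈D with privates z z∈D
      ... | u , _ , _ , only with dom′ u u
      ...   | e , e∈D′ , eu = subst (_∈ D′) (only e (D′⊆D e∈D′) eu) e∈D′

module InducedLists {n : ℕ} (G : Graph n) where
  open Graphs G

  -- PathList vs: vs lists the vertices of an induced path from one end; each
  -- vertex is adjacent to the next one and misses all later ones.
  PathList : List V → Set
  PathList []           = ⊤
  PathList (v ∷ [])     = ⊤
  PathList (v ∷ w ∷ ws) = Adj G v w × All (NC v) ws × PathList (w ∷ ws)

  Ends : V → List V → Set
  Ends x []           = Empty
  Ends x (v ∷ [])     = Adj G x v
  Ends x (v ∷ w ∷ ws) = NC x v × Ends x (w ∷ ws)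

  -- CycleList x p ps: x closes the induced path p ∷ ps into an induced cycle.
  CycleList : V → V → List V → Set
  CycleList x p ps = Adj G x p × Ends x ps × PathList (p ∷ ps)

  induced-by : ∀ {m} (f : Fin m → V) (S : Fin m → Fin m → Set) →
               (∀ {i j} → S i j → S j i) → (∀ {i} → ¬ S i i) → (∀ i j → Dec (S i j)) →
               (∀ i j → toℕ i < toℕ j → (S i j → Adj G (f i) (f j)) × (¬ S i j → NC (f i) (f j))) →
               (∀ i j → f i ≡ f j → i ≡ j) × (∀ i j → Adj G (f i) (f j) ⇔ S i j)
  induced-by f S S-sym S-irrefl S? order = injective , λ i j → mk⇔ (to i j) (from i j)
    where
      apart : ∀ i j → toℕ i < toℕ j → f i ≢ f j
      apart i j i<j fi≡fj with S? i j
      ... | yes s = Adj⇒≢ (proj₁ (order i j i<j) s) fi≡fj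
      ... | no ¬s = proj₂ (order i j i<j) ¬s (inj₁ fi≡fj)

      injective : ∀ i j → f i ≡ f j → i ≡ j
      injective i j fi≡fj with <-cmp (toℕ i) (toℕ j)
      ... | tri< i<j _ _ = ⊥-elim (apart i j i<j fi≡fj)
      ... | tri≈ _ i≡j _ = toℕ-injective i≡j
      ... | tri> _ _ j<i = ⊥-elim (apart j i j<i (sym fi≡fj))

      forward : ∀ i j → toℕ i < toℕ j → Adj G (f i) (f j) → S i j
      forward i j i<j fifj with S? i j
      ... | yes s = s
      ... | no ¬s = ⊥-elim (proj₂ (order i j i<j) ¬s (inj₂ fifj))

      to : ∀ i j → Adj G (f i) (f j) → S i j
      to i j fifj with <-cmp (toℕ i) (toℕ j)
      ... | tri< i<j _ _ = forward i j i<j fifj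
      ... | tri≈ _ i≡j _ = ⊥-elim (Adj⇒≢ fifj (cong f (toℕ-injective i≡j)))
      ... | tri> _ _ j<i = S-sym (forward j i j<i (Adj-sym fifj))

      from : ∀ i j → S i j → Adj G (f i) (f j)
      from i j s with <-cmp (toℕ i) (toℕ j)
      ... | tri< i<j _ _ = proj₁ (order i j i<j) s
      ... | tri≈ _ i≡j _ = ⊥-elim (S-irrefl (subst (S i) (sym (toℕ-injective i≡j)) s))
      ... | tri> _ _ j<i = Adj-sym (proj₁ (order j i j<i) (S-sym s))

  path-order : ∀ vs → PathList vs → ∀ i j → toℕ i < toℕ j →
               (toℕ j ≡ suc (toℕ i) → Adj G (lookup vs i) (lookup vs j)) ×
               (toℕ j ≢ suc (toℕ i) → NC (lookup vs i) (lookup vs j))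
  path-order (v ∷ w ∷ ws) (vw , _ , _) fzero (fsuc fzero) _ =
    (λ _ → vw) , (λ ¬next → ⊥-elim (¬next refl))
  path-order (v ∷ w ∷ ws) (_ , v≁ws , _) fzero (fsuc (fsuc k)) _ =
    (λ ()) , (λ _ → All-lookup v≁ws (∈-lookup k))
  path-order (v ∷ w ∷ ws) (_ , _ , path) (fsuc i) (fsuc j) (s≤s i<j)
    with path-order (w ∷ ws) path i j i<j
  ... | adj , nonadj = adj ∘ suc-injective , λ ¬next → nonadj (¬next ∘ cong suc)

  Consecutive : ∀ {m} → Fin m → Fin m → Set
  Consecutive i j = (toℕ j ≡ suc (toℕ i)) ⊎ (toℕ i ≡ suc (toℕ j))

  path-induced : ∀ vs → PathList vs → IsInducedPath G (length vs) (lookup vs)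
  path-induced vs path = induced-by (lookup vs) Consecutive swap irrefl′ dec order
    where
      irrefl′ : ∀ {i} → ¬ Consecutive i i
      irrefl′ (inj₁ e) = 1+n≢n (sym e)
      irrefl′ (inj₂ e) = 1+n≢n (sym e)

      dec : ∀ i j → Dec (Consecutive i j)
      dec i j = (toℕ j ≟ⁿ suc (toℕ i)) ⊎-dec (toℕ i ≟ⁿ suc (toℕ j))

      order : ∀ i j → toℕ i < toℕ j →
              (Consecutive i j → Adj G (lookup vs i) (lookup vs j)) ×
              (¬ Consecutive i j → NC (lookup vs i) (lookup vs j))
      order i j i<j with path-order vs path i j i<j
      ... | adj , nonadj =
        [ adj , (λ e → ⊥-elim (<-asym i<j (≤-reflexive (sym e)))) ]′ , λ ¬c → nonadj (¬c ∘ inj₁)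

  ends-order : ∀ x v vs → Ends x (v ∷ vs) → ∀ k →
               (toℕ k ≡ length vs → Adj G x (lookup (v ∷ vs) k)) ×
               (toℕ k ≢ length vs → NC x (lookup (v ∷ vs) k))
  ends-order x v [] xv fzero = (λ _ → xv) , (λ ¬next → ⊥-elim (¬next refl))
  ends-order x v (w ∷ ws) (x≁v , _) fzero = (λ ()) , (λ _ → x≁v)
  ends-order x v (w ∷ ws) (_ , ends) (fsuc k) with ends-order x w ws ends k
  ... | adj , nonadj = adj ∘ suc-injective , λ ¬next → nonadj (¬next ∘ cong suc)

  CycleStep : ∀ {m} → Fin m → Fin m → Set
  CycleStep {m} i j = (toℕ j ≡ suc (toℕ i)) ⊎ ((toℕ i ≡ 0) × (toℕ j ≡ m ∸ 1))

  cycle-order : ∀ x p ps → CycleList x p ps → ∀ i j → toℕ i < toℕ j →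
                (CycleStep i j → Adj G (lookup (x ∷ p ∷ ps) i) (lookup (x ∷ p ∷ ps) j)) ×
                (¬ CycleStep i j → NC (lookup (x ∷ p ∷ ps) i) (lookup (x ∷ p ∷ ps) j))
  cycle-order x p ps (xp , _ , _) fzero (fsuc fzero) _ =
    (λ _ → xp) , (λ ¬s → ⊥-elim (¬s (inj₁ refl)))
  cycle-order x p [] _ fzero (fsuc (fsuc ())) _
  cycle-order x p (q ∷ qs) (_ , ends , _) fzero (fsuc (fsuc k)) _ with ends-order x q qs ends k
  ... | adj , nonadj =
    [ (λ ()) , (λ (_ , last) → adj (suc-injective (suc-injective last))) ]′ ,
    λ ¬s → nonadj (λ last → ¬s (inj₂ (refl , cong (suc ∘ suc) last)))
  cycle-order x p ps (_ , _ , path) (fsuc i) (fsuc j) (s≤s i<j) with path-order (p ∷ ps) path i j i<j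
  ... | adj , nonadj = [ adj ∘ suc-injective , (λ { (() , _) }) ]′ , λ ¬s → nonadj (¬s ∘ inj₁ ∘ cong suc)

  Around : ∀ {m} → Fin m → Fin m → Set
  Around {m} i j = CycNext G m i j ⊎ CycNext G m j i

  cycle-induced : ∀ x p ps → CycleList x p ps →
                  IsInducedCycle G (length (x ∷ p ∷ ps)) (lookup (x ∷ p ∷ ps))
  cycle-induced x p ps cycle = induced-by (lookup (x ∷ p ∷ ps)) Around swap irrefl′ dec order
    where
      next-irrefl : ∀ {i} → ¬ CycNext G (length (x ∷ p ∷ ps)) i i
      next-irrefl (inj₁ e)           = 1+n≢n (sym e)
      next-irrefl (inj₂ (last , first)) with trans (sym last) first
      ... | ()

      irrefl′ : ∀ {i} → ¬ Around i i
      irrefl′ (inj₁ s) = next-irrefl s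
      irrefl′ (inj₂ s) = next-irrefl s

      next? : ∀ i j → Dec (CycNext G (length (x ∷ p ∷ ps)) i j)
      next? i j = (toℕ j ≟ⁿ suc (toℕ i)) ⊎-dec ((toℕ i ≟ⁿ suc (length ps)) ×-dec (toℕ j ≟ⁿ 0))

      dec : ∀ i j → Dec (Around i j)
      dec i j = next? i j ⊎-dec next? j i

      to-step : ∀ {i j} → toℕ i < toℕ j → Around i j → CycleStep i j
      to-step i<j (inj₁ (inj₁ e))             = inj₁ e
      to-step i<j (inj₁ (inj₂ (_ , j≡0)))     = ⊥-elim (n≮0 (subst (_ <_) j≡0 i<j))
      to-step i<j (inj₂ (inj₁ e))             = ⊥-elim (<-asym i<j (≤-reflexive (sym e)))
      to-step i<j (inj₂ (inj₂ (last , first))) = inj₂ (first , last)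

      from-step : ∀ {i j} → CycleStep i j → Around i j
      from-step (inj₁ e)              = inj₁ (inj₁ e)
      from-step (inj₂ (first , last)) = inj₂ (inj₂ (last , first))

      order : ∀ i j → toℕ i < toℕ j →
              (Around i j → Adj G (lookup (x ∷ p ∷ ps) i) (lookup (x ∷ p ∷ ps) j)) ×
              (¬ Around i j → NC (lookup (x ∷ p ∷ ps) i) (lookup (x ∷ p ∷ ps) j))
      order i j i<j with cycle-order x p ps cycle i j i<j
      ... | adj , nonadj = adj ∘ to-step i<j , λ ¬a → nonadj (¬a ∘ from-step)

-- Induced paths in chordal graphs: a neighbour of the head of an induced path
-- that misses the second vertex misses the whole path, so induced paths can be
-- extended and glued.
module Chordality {n : ℕ} (G : Graph n) (chordal : Chordal G) where
  open Graphs G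
  open InducedLists G

  -- no vertex closes an induced path on at least three vertices into a cycle:
  -- such a cycle would be a hole of length at least four
  no-hole : ∀ {x p q rs} → PathList (p ∷ q ∷ rs) → Adj G x p → NC x q → Ends x rs → Empty
  no-hole {rs = []} _ _ _ ()
  no-hole {x} {p} {q} {r ∷ rs} path xp x≁q ends =
    chordal (length (x ∷ p ∷ q ∷ r ∷ rs)) (s≤s (s≤s (s≤s (s≤s z≤n)))) (lookup (x ∷ p ∷ q ∷ r ∷ rs))
            (cycle-induced x p (q ∷ r ∷ rs) (xp , (x≁q , ends) , path))

  up-to-first : ∀ {x vs} → First (NC x) (Adj G x) vs → List V
  up-to-first {vs = v ∷ _} [ _ ]   = v ∷ []
  up-to-first {vs = v ∷ _} (_ ∷ h) = v ∷ up-to-first h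

  up-to-first-ends : ∀ {x vs} (h : First (NC x) (Adj G x) vs) → Ends x (up-to-first h)
  up-to-first-ends [ xv ]             = xv
  up-to-first-ends (x≁v ∷ h@([ _ ])) = x≁v , up-to-first-ends h
  up-to-first-ends (x≁v ∷ h@(_ ∷ _)) = x≁v , up-to-first-ends h

  up-to-first-all : ∀ {P : V → Set} {x vs} (h : First (NC x) (Adj G x) vs) → All P vs → All P (up-to-first h)
  up-to-first-all [ _ ]   (pv ∷ _)   = pv ∷ []
  up-to-first-all (_ ∷ h) (pv ∷ pvs) = pv ∷ up-to-first-all h pvs

  up-to-first-path : ∀ {x v vs} (h : First (NC x) (Adj G x) vs) → PathList (v ∷ vs) → PathList (v ∷ up-to-first h)
  up-to-first-path [ _ ]   (vw , _ , _)        = vw , [] , tt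
  up-to-first-path (_ ∷ h) (vw , v≁ws , path) = vw , up-to-first-all h v≁ws , up-to-first-path h path

  -- a neighbour x of the head p of an induced path, missing its second vertex q,
  -- has no first neighbour further along: the cycle it would close is a hole
  fan : ∀ {x p q qs} → PathList (p ∷ q ∷ qs) → Adj G x p → NC x q → First (NC x) (Adj G x) qs → Empty
  fan (pq , p≁qs , path) xp x≁q h =
    no-hole (pq , up-to-first-all h p≁qs , up-to-first-path h path) xp x≁q (up-to-first-ends h)

  -- scanning the vertices missed by v for a first neighbour of a neighbour w of v;
  -- w itself cannot occur since v misses it
  scan : ∀ {v w vs} → Adj G w v → All (NC v) vs → First (NC w) (Adj G w) vs ⊎ All (NC w) vs
  scan wv [] = inj₂ []
  scan {w = w} {vs = t ∷ _} wv (v≁t ∷ v≁ts) with CAdj? w t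
  ... | yes (inj₁ refl) = ⊥-elim (v≁t (inj₂ (Adj-sym wv)))
  ... | yes (inj₂ wt)   = inj₁ [ wt ]
  ... | no w≁t          = ⊎-map (w≁t ∷_) (w≁t ∷_) (scan wv v≁ts)

  extend : ∀ {w v u us} → PathList (v ∷ u ∷ us) → Adj G w v → NC w u → PathList (w ∷ v ∷ u ∷ us)
  extend path@(_ , v≁us , _) wv w≁u with scan wv v≁us
  ... | inj₁ h     = ⊥-elim (fan path wv w≁u h)
  ... | inj₂ w≁us = wv , w≁u ∷ w≁us , path

  -- two induced paths leaving y whose second vertices are non-adjacent form one
  -- induced path through y, adding the vertices of the second path one by one
  glue : ∀ {y z zs b bs} → PathList (y ∷ z ∷ zs) → PathList (y ∷ b ∷ bs) → NC b z →
         PathList (bs ʳ++ (b ∷ y ∷ z ∷ zs))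
  glue {bs = []}     path (yb , _ , _)        b≁z = extend path (Adj-sym yb) b≁z
  glue {bs = c ∷ cs} path (yb , y≁c ∷ _ , rest) b≁z =
    glue (extend path (Adj-sym yb) b≁z) rest (NC-sym y≁c)

  Arm : V → V → Set
  Arm x a = ∃[ a₂ ] ∃[ a₃ ] ∃[ a₄ ] PathList (x ∷ a ∷ a₂ ∷ a₃ ∷ a₄ ∷ [])

  -- a path on five vertices whose vertices at distance two are non-adjacent is an
  -- arm; it is built by extension from the far end a₄ and then read from x
  arm : ∀ {x a₁ a₂ a₃ a₄} → Adj G x a₁ → Adj G a₁ a₂ → Adj G a₂ a₃ → Adj G a₃ a₄ →
        NC x a₂ → NC a₁ a₃ → NC a₂ a₄ → Arm x a₁
  arm x~a₁ a₁~a₂ a₂~a₃ a₃~a₄ x≁a₂ a₁≁a₃ a₂≁a₄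
    with extend (Adj-sym a₁~a₂ , NC-sym x≁a₂ ∷ [] , Adj-sym x~a₁ , [] , tt) (Adj-sym a₂~a₃) (NC-sym a₁≁a₃)
  ... | path₄@(_ , _ ∷ a₃≁x ∷ [] , _) with extend path₄ (Adj-sym a₃~a₄) (NC-sym a₂≁a₄)
  ...   | (_ , _ ∷ a₄≁a₁ ∷ a₄≁x ∷ [] , _) =
    _ , _ , _ , x~a₁ , (x≁a₂ ∷ NC-sym a₃≁x ∷ NC-sym a₄≁x ∷ []) ,
                a₁~a₂ , (a₁≁a₃ ∷ NC-sym a₄≁a₁ ∷ []) ,
                a₂~a₃ , (a₂≁a₄ ∷ []) ,
                a₃~a₄ , [] , tt

  arms-meet : PFree G 9 → ∀ {x a b} → Arm x a → Arm x b → NC a b → Empty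
  arms-meet p9 (_ , _ , _ , arm-a) (_ , _ , _ , arm-b) a≁b =
    p9 _ (path-induced _ (glue arm-a arm-b (NC-sym a≁b)))

module Irredundance {n : ℕ} (G : Graph n) (irr : Subset n) (choice : IsIRChoice G irr) where
  open Graphs G
  open Domination G
  open IsIRChoice choice
  open IsIRComponent

  escape : ∀ {x y} → ¬ NcSub G x y → ∃[ z ] (CAdj G x z × NC y z)
  escape {x} {y} x⊈y with inclusion? (CAdj? x) (CAdj? y)
  ... | inj₁ x⊆y = ⊥-elim (x⊈y x⊆y)
  ... | inj₂ z   = z

  irr-incomparable : ∀ {a b} → a ∈ irr → b ∈ irr → a ≢ b → ¬ NcSub G b a
  irr-incomparable {a} {b} a∈irr b∈irr a≢b b⊆a =
    a≢b (chosen-unique a b a∈irr b∈irr (chosen-minimal a a∈irr b b⊆a) b⊆a)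

  -- N[y] as a subset, the measure for descending to irredundant vertices
  closedNbhd : V → Subset n
  closedNbhd y = tabulate (λ z → does (CAdj? y z))

  closedNbhd⁺ : ∀ {y z} → CAdj G y z → z ∈ closedNbhd y
  closedNbhd⁺ {y} {z} yz =
    lookup⇒[]= z (closedNbhd y) (trans (lookup∘tabulate _ z) (dec-true (CAdj? y z) yz))

  closedNbhd⁻ : ∀ {y z} → z ∈ closedNbhd y → CAdj G y z
  closedNbhd⁻ {y} {z} z∈ = sound (CAdj? y z) (trans (sym (lookup∘tabulate _ z)) ([]=⇒lookup z∈))
    where
      sound : (d : Dec (CAdj G y z)) → does d ≡ true → CAdj G y z
      sound (yes yz) _ = yz
      sound (no _)   ()

  to-irr : ∀ y → ∃[ w ] (w ∈ irr × NcSub G w y)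
  to-irr y = descend y (⊂-wellFounded (closedNbhd y))
    where
      descend : ∀ y → Acc _⊂_ (closedNbhd y) → ∃[ w ] (w ∈ irr × NcSub G w y)
      descend y (acc smaller) with inclusion? (λ y′ → NcSub? y′ y) (λ y′ → NcSub? y y′)
      ... | inj₁ minimal with chosen-exists y minimal
      ...   | w , w∈irr , _ , w⊆y = w , w∈irr , w⊆y
      descend y (acc smaller) | inj₂ (y′ , y′⊆y , y⊈y′) with escape y⊈y′
      ... | z , yz , y′≁z
        with descend y′ (smaller ((λ {v} v∈ → closedNbhd⁺ (y′⊆y v (closedNbhd⁻ v∈))) ,
                                   z , closedNbhd⁺ yz , y′≁z ∘ closedNbhd⁻))
      ...   | w , w∈irr , w⊆y′ = w , w∈irr , λ v wv → y′⊆y v (w⊆y′ v wv)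

  dominate-irr : ∀ D → (∀ y → y ∈ irr → InNc G D y) → Dom D
  dominate-irr D dom-irr y _ with to-irr y
  ... | w , w∈irr , w⊆y with dom-irr w w∈irr
  ...   | d , d∈D , dw = d , d∈D , CAdj-sym (w⊆y d (CAdj-sym dw))

  private-irr : ∀ {D z u} → Dom D → Priv G D z u → ∃[ w ] PrivIR G irr D z w
  private-irr {u = u} dom (z∈D , zu , only) with to-irr u
  ... | w , w∈irr , w⊆u with dom w w
  ...   | d , d∈D , dw with only d d∈D (CAdj-sym (w⊆u d (CAdj-sym dw)))
  ...     | refl = w , (z∈D , dw , λ y y∈D yw → only y y∈D (CAdj-sym (w⊆u y (CAdj-sym yw)))) , w∈irr

  has-irr-private : ∀ {D z} → MinDom G D → z ∈ D → ∃[ w ] PrivIR G irr D z w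
  has-irr-private minDom z∈D = private-irr (proj₁ minDom) (proj₂ (has-private minDom z∈D))

  Closed : Subset n → Set
  Closed C = ∀ x y → x ∈ C → y ∈ irr → Adj G x y → y ∈ C

  reach-closed : ∀ {S C a b} → Closed C → S ⊆ irr → a ∈ C → Reach G S a b → Reach G C a b
  reach-closed closed S⊆irr a∈C (here _) = here a∈C
  reach-closed closed S⊆irr a∈C (step r y∈S xy) =
    let r′ = reach-closed closed S⊆irr a∈C r in step r′ (closed _ _ (reach-end r′) (S⊆irr y∈S) xy) xy

  Grown : V → Subset n → Set
  Grown w T = w ∈ T × T ⊆ irr × (∀ v → v ∈ T → Reach G irr w v)

  saturate : ∀ {w} T → Acc _⊃_ T → Grown w T → ∃[ C ] (Grown w C × Closed C)
  saturate T (acc larger) grown@(w∈T , T⊆irr , reach)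
    with inclusion? (λ y → (y ∈? irr) ×-dec any? (λ x → (x ∈? T) ×-dec Adj? x y)) (_∈? T)
  ... | inj₁ closed = T , grown , λ x y x∈T y∈irr xy → closed y (y∈irr , x , x∈T , xy)
  ... | inj₂ (y , (y∈irr , x , x∈T , xy) , y∉T) =
    saturate (T ∪ ⁅ y ⁆) (larger (p⊆p∪q _ , y , ∪ʳ (x∈⁅x⁆ y) , y∉T)) (p⊆p∪q _ w∈T , ⊆irr , reach′)
    where
      added : ∀ {v} → v ∈ T ∪ ⁅ y ⁆ → v ∈ T ⊎ v ≡ y
      added v∈ = ⊎-map (λ v∈T → v∈T) (x∈⁅y⁆⇒x≡y y) (x∈p∪q⁻ T ⁅ y ⁆ v∈)

      ⊆irr : T ∪ ⁅ y ⁆ ⊆ irr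
      ⊆irr v∈ with added v∈
      ... | inj₁ v∈T  = T⊆irr v∈T
      ... | inj₂ refl = y∈irr

      reach′ : ∀ v → v ∈ T ∪ ⁅ y ⁆ → Reach G irr _ v
      reach′ v v∈ with added v∈
      ... | inj₁ v∈T  = reach v v∈T
      ... | inj₂ refl = step (reach x x∈T) y∈irr xy

  component : ∀ w → w ∈ irr → ∃[ C ] (IsIRComponent G irr C × w ∈ C)
  component w w∈irr with saturate ⁅ w ⁆ (⊃-wellFounded _) (x∈⁅x⁆ w , single⊆irr , single-reach)
    where
      single⊆irr : ⁅ w ⁆ ⊆ irr
      single⊆irr v∈ = subst (_∈ irr) (sym (x∈⁅y⁆⇒x≡y w v∈)) w∈irr
      single-reach : ∀ v → v ∈ ⁅ w ⁆ → Reach G irr w v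
      single-reach v v∈ = subst (Reach G irr w) (sym (x∈⁅y⁆⇒x≡y w v∈)) (here w∈irr)
  ... | C , (w∈C , C⊆irr , reach) , closedC =
    C , record { nonempty = w , w∈C ; inside = C⊆irr ; connected = connectedC ; closed = closedC } , w∈C
    where
      from-w : ∀ v → v ∈ C → Reach G C w v
      from-w v v∈C = reach-closed closedC (λ v∈ → v∈) w∈C (reach v v∈C)
      connectedC : ∀ x y → x ∈ C → y ∈ C → Reach G C x y
      connectedC x y x∈C y∈C = reach-trans (reach-rev (from-w x x∈C)) (from-w y y∈C)

  absorbs : ∀ {C y d} → IsIRComponent G irr C → y ∈ C → d ∈ irr → CAdj G d y → d ∈ C
  absorbs icC y∈C d∈irr (inj₁ refl) = y∈C
  absorbs icC y∈C d∈irr (inj₂ dy)   = closed icC _ _ y∈C d∈irr (Adj-sym dy)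

  component-⊆ : ∀ {C C′ w} → IsIRComponent G irr C → IsIRComponent G irr C′ → w ∈ C → w ∈ C′ → C′ ⊆ C
  component-⊆ icC icC′ w∈C w∈C′ v∈C′ =
    reach-end (reach-closed (closed icC) (inside icC′) w∈C (connected icC′ _ _ w∈C′ v∈C′))

  arm-into : (chordal : Chordal G) → ∀ {C x u y} → IsIRComponent G irr C → x ∉ C →
             Reach G C u y → Adj G x u → NC x y → ∃[ a ] (a ∈ C × Chordality.Arm G chordal x a)
  arm-into chordal icC x∉C walk xu x≁y with leave x∉C walk xu x≁y
  ... | a₁ , a₂ , a₁∈C , a₂∈C , x~a₁ , a₁~a₂ , x≁a₂
    with escape (irr-incomparable (inside icC a₁∈C) (inside icC a₂∈C) (Adj⇒≢ a₁~a₂))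
  ... | a₃ , a₂a₃ , a₁≁a₃
    with escape (λ a₃⊆a₂ → a₁≁a₃ (CAdj-sym (chosen-minimal _ (inside icC a₂∈C) _ a₃⊆a₂ _ (inj₂ (Adj-sym a₁~a₂)))))
  ... | a₄ , a₃a₄ , a₂≁a₄ =
    a₁ , a₁∈C , Chordality.arm G chordal x~a₁ a₁~a₂ a₂~a₃ (CAdj-away a₂~a₃ a₃a₄ a₂≁a₄) x≁a₂ a₁≁a₃ a₂≁a₄
    where a₂~a₃ = CAdj-away a₁~a₂ a₂a₃ a₁≁a₃

module Extension {n : ℕ} (G : Graph n) (irr : Subset n) (choice : IsIRChoice G irr)
                 (p9 : PFree G 9) (chordal : Chordal G)
                 (A : Subset n) (A∈DRN : InDRN G irr A) (I : Subset n) (I⊆irr : I ⊆ irr) where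
  open Graphs G
  open Domination G
  open Irredundance G irr choice
  open Chordality G chordal using (arms-meet)
  open IsIRComponent

  D₀ : Subset n
  D₀ = proj₁ A∈DRN

  D₀-minimal : MinDom G D₀
  D₀-minimal = proj₁ (proj₂ A∈DRN)

  A⊆D₀ : A ⊆ D₀
  A⊆D₀ {a} a∈A = proj₁ (Equivalence.to (proj₂ (proj₂ A∈DRN) a) a∈A)

  A-redundant : ∀ {a} → a ∈ A → a ∉ irr
  A-redundant {a} a∈A = proj₂ (Equivalence.to (proj₂ (proj₂ A∈DRN) a) a∈A)

  outside-N[A] : ∀ {y} → y ∈ irr → ¬ InNo G A y → ¬ InNc G A y
  outside-N[A] y∈irr y∉N y∈N[A] = y∉N (y∈N[A] , λ y∈A → A-redundant y∈A y∈irr)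

  -- Lemma: every element z of a set D minimal for conditions (1)-(2) has a
  -- private neighbour in C ∖ N(A); otherwise D - z would satisfy them too
  cond-private : ∀ {C D z} → MinCond G irr A C D → z ∈ D →
                 ∃[ y ] (y ∈ C × ¬ InNo G A y × CAdj G z y × (∀ e → e ∈ D → CAdj G e y → e ≡ z))
  cond-private {C} {D} {z} ((D⊆C , cond₁ , cond₂) , minimal) z∈D
    with inclusion? (λ y → (y ∈? C) ×-dec ¬? (InNo? A y)) (InNc? (D - z))
  ... | inj₁ still-dom = ⊥-elim (minimal-without minimal z∈D (D⊆C ∘ D-z⊆D , still-dom , cond₂′))
    where
      D-z⊆D : D - z ⊆ D
      D-z⊆D = proj₁ (x∈p⇒p-x⊂p z∈D)
      cond₂′ : ∀ x → InRC G irr A C x → ¬ Dominates G (D - z) (PrivIR G irr A x)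
      cond₂′ x x∈R dom = cond₂ x x∈R (λ y p → InNc-mono D-z⊆D (dom y p))
  ... | inj₂ (y , (y∈C , y∉N) , undominated) with cond₁ y (y∈C , y∉N)
  ...   | e , e∈D , ey =
    y , y∈C , y∉N , subst (λ t → CAdj G t y) (sole-neighbour undominated e∈D ey) ey ,
    λ e′ e′∈D e′y → sole-neighbour undominated e′∈D e′y

  empty-cond : ∀ {C} → IsIRComponent G irr C → (∀ v → v ∈ C → InNo G A v) → Cond G irr A C ∅
  empty-cond icC C⊆N =
    (λ x∈∅ → ⊥-elim (∉⊥ x∈∅)) ,
    (λ y (y∈C , y∉N) → ⊥-elim (y∉N (C⊆N y y∈C))) ,
    λ x (_ , u , pu , u∈C) dom → ∉⊥ (proj₁ (proj₂ (dom u (pu , inside icC u∈C))))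

  -- Key lemma: an element z of R(A) has an arm into every component containing
  -- one of its irredundant private neighbours, since such a component is not
  -- contained in N(A) ...
  arm-toward : ∀ {z u C} → z ∈ A → ¬ InB G irr A z → PrivIR G irr A z u →
               IsIRComponent G irr C → u ∈ C → ∃[ a ] (a ∈ C × Chordality.Arm G chordal z a)
  arm-toward {z} {u} {C} z∈A z∉B pu@((_ , zu , _) , u∈irr) icC u∈C with inclusion? (_∈? C) (InNo? A)
  ... | inj₁ C⊆N = ⊥-elim (z∉B (z∈A , u , pu , C , icC , u∈C , C⊆N))
  ... | inj₂ (v , v∈C , v∉N) = arm-into chordal icC z∉C (connected icC u v u∈C v∈C) z~u z≁v
    where
      z∉C : z ∉ C
      z∉C z∈C = A-redundant z∈A (inside icC z∈C)
      z~u : Adj G z u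
      z~u = CAdj-≢ zu λ { refl → A-redundant z∈A u∈irr }
      z≁v : NC z v
      z≁v zv = outside-N[A] (inside icC v∈C) v∉N (z , z∈A , zv)

  -- ... hence, as G is P₉-free, all its irredundant private neighbours lie in one component
  same-component : ∀ {z u w C} → z ∈ A → ¬ InB G irr A z → PrivIR G irr A z u → PrivIR G irr A z w →
                   IsIRComponent G irr C → u ∈ C → w ∈ C
  same-component {w = w} {C} z∈A z∉B pu pw icC u∈C with w ∈? C
  ... | yes w∈C = w∈C
  ... | no w∉C with component w (proj₂ pw)
  ...   | C′ , icC′ , w∈C′ with arm-toward z∈A z∉B pu icC u∈C | arm-toward z∈A z∉B pw icC′ w∈C′
  ...     | a , a∈C , arm-a | b , b∈C′ , arm-b = ⊥-elim (arms-meet p9 arm-a arm-b apart)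
    where
      apart : NC a b
      apart ab = w∉C (component-⊆ icC icC′ (absorbs icC a∈C (inside icC′ b∈C′) (CAdj-sym ab)) b∈C′ w∈C′)

  forward : MinDom G (A ∪ I) → ∀ C → IsIRComponent G irr C → MinCond G irr A C (I ∩ C)
  forward minDom@(dom , _) C icC = (∩ʳ , cond₁ , cond₂) , minimal
    where
      cond₁ : Dominates G (I ∩ C) (λ y → y ∈ C × ¬ InNo G A y)
      cond₁ y (y∈C , y∉N) with dom y y
      ... | d , d∈A∪I , dy with x∈p∪q⁻ A I d∈A∪I
      ...   | inj₁ d∈A = ⊥-elim (outside-N[A] (inside icC y∈C) y∉N (d , d∈A , dy))
      ...   | inj₂ d∈I = d , x∈p∩q⁺ (d∈I , absorbs icC y∈C (I⊆irr d∈I) dy) , dy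

      -- x ∈ A keeps an irredundant private neighbour, which I does not dominate
      cond₂ : ∀ x → InRC G irr A C x → ¬ Dominates G (I ∩ C) (PrivIR G irr A x)
      cond₂ x ((x∈A , _) , _) dom-priv with has-irr-private minDom (∪ˡ x∈A)
      ... | w , (_ , xw , only) , w∈irr with dom-priv w ((x∈A , xw , λ y y∈A → only y (∪ˡ y∈A)) , w∈irr)
      ...   | e , e∈I∩C , ew = A-redundant x∈A (subst (_∈ irr) (only e (∪ʳ (∩ˡ e∈I∩C)) ew) (I⊆irr (∩ˡ e∈I∩C)))

      -- each z ∈ I ∩ C has a private neighbour in C ∖ N(A) that only z can dominate
      minimal : ∀ D′ → D′ ⊆ I ∩ C → Cond G irr A C D′ → I ∩ C ⊆ D′
      minimal D′ D′⊆ (_ , cond₁′ , _) {z} z∈I∩C with has-irr-private minDom (∪ʳ (∩ˡ z∈I∩C))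
      ... | y , (_ , zy , only) , y∈irr with cond₁′ y (absorbs icC (∩ʳ z∈I∩C) y∈irr (CAdj-sym zy) , y∉N)
        where
          y∉N : ¬ InNo G A y
          y∉N ((a , a∈A , ay) , _) =
            A-redundant a∈A (subst (_∈ irr) (sym (only a (∪ˡ a∈A) ay)) (I⊆irr (∩ˡ z∈I∩C)))
      ...   | e , e∈D′ , ey = subst (_∈ D′) (only e (∪ʳ (∩ˡ (D′⊆ e∈D′))) ey) e∈D′

  module Backward (solutions : ∀ C → IsIRComponent G irr C → MinCond G irr A C (I ∩ C)) where

    dominating : Dom (A ∪ I)
    dominating = dominate-irr (A ∪ I) dom-irr
      where
        dom-irr : ∀ y → y ∈ irr → InNc G (A ∪ I) y
        dom-irr y y∈irr with InNc? A y
        ... | yes y∈N[A] = InNc-mono ∪ˡ y∈N[A]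
        ... | no y∉N[A] with component y y∈irr
        ...   | C , icC , y∈C with solutions C icC
        ...     | (_ , cond₁ , _) , _ = InNc-mono (λ v∈ → ∪ʳ (∩ˡ v∈)) (cond₁ y (y∈C , y∉N[A] ∘ proj₁))

    -- a component inside N(A) receives no vertex of I, as ∅ already solves it there
    no-I-inside-N[A] : ∀ {C x} → IsIRComponent G irr C → (∀ v → v ∈ C → InNo G A v) → x ∉ I ∩ C
    no-I-inside-N[A] {C} icC C⊆N x∈I∩C =
      ∉⊥ (proj₂ (solutions C icC) ∅ (λ x∈∅ → ⊥-elim (∉⊥ x∈∅)) (empty-cond icC C⊆N) x∈I∩C)

    -- z ∈ I keeps its private neighbour in C ∖ N(A) from the minimality of I ∩ C
    private-of-I : ∀ z → z ∈ I → ∃[ u ] Priv G (A ∪ I) z u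
    private-of-I z z∈I with component z (I⊆irr z∈I)
    ... | C , icC , z∈C with cond-private (solutions C icC) (x∈p∩q⁺ (z∈I , z∈C))
    ...   | y , y∈C , y∉N , zy , only = y , ∪ʳ z∈I , zy , only′
      where
        only′ : ∀ e → e ∈ A ∪ I → CAdj G e y → e ≡ z
        only′ e e∈A∪I ey with x∈p∪q⁻ A I e∈A∪I
        ... | inj₁ e∈A = ⊥-elim (outside-N[A] (inside icC y∈C) y∉N (e , e∈A , ey))
        ... | inj₂ e∈I = only e (x∈p∩q⁺ (e∈I , absorbs icC y∈C (I⊆irr e∈I) ey)) ey

    -- I cannot dominate all irredundant private neighbours of z ∈ A: z ∉ B(A), as
    -- a component inside N(A) has no vertex of I; so z ∈ R_C(A) for the component
    -- C of such a neighbour, which contains all of them, and (2) applies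
    undominated : ∀ {z} → z ∈ A → ¬ (∀ w → PrivIR G irr A z w → InNc G I w)
    undominated {z} z∈A I-dom with has-irr-private D₀-minimal (A⊆D₀ z∈A)
    ... | u , (pu₀ , u∈irr) with component u u∈irr
    ...   | C , icC , u∈C with solutions C icC
    ...     | (_ , _ , cond₂) , _ = cond₂ z ((z∈A , z∉B) , u , pu , u∈C) I∩C-dom
      where
        pu : Priv G A z u
        pu = Priv-restrict A⊆D₀ z∈A pu₀

        z∉B : ¬ InB G irr A z
        z∉B (_ , u′ , pu′ , C′ , icC′ , u′∈C′ , C′⊆N) with I-dom u′ pu′
        ... | e , e∈I , eu′ =
          no-I-inside-N[A] icC′ C′⊆N (x∈p∩q⁺ (e∈I , absorbs icC′ u′∈C′ (I⊆irr e∈I) eu′))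

        I∩C-dom : Dominates G (I ∩ C) (PrivIR G irr A z)
        I∩C-dom w pw with I-dom w pw
        ... | e , e∈I , ew =
          e , x∈p∩q⁺ (e∈I , absorbs icC (same-component z∈A z∉B (pu , u∈irr) pw icC u∈C) (I⊆irr e∈I) ew) , ew

    private-of-A : ∀ z → z ∈ A → ∃[ u ] Priv G (A ∪ I) z u
    private-of-A z z∈A with inclusion? (λ w → Priv? A z w ×-dec (w ∈? irr)) (InNc? I)
    ... | inj₁ I-dom = ⊥-elim (undominated z∈A I-dom)
    ... | inj₂ (w , ((_ , zw , only) , _) , w∉N[I]) = w , ∪ˡ z∈A , zw , only′
      where
        only′ : ∀ e → e ∈ A ∪ I → CAdj G e w → e ≡ z
        only′ e e∈A∪I ew with x∈p∪q⁻ A I e∈A∪I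
        ... | inj₁ e∈A = only e e∈A ew
        ... | inj₂ e∈I = ⊥-elim (w∉N[I] (e , e∈I , ew))

    backward : MinDom G (A ∪ I)
    backward = from-private (A ∪ I) dominating λ z z∈A∪I →
      [ private-of-A z , private-of-I z ]′ (x∈p∪q⁻ A I z∈A∪I)

theorem9 : ∀ {n : ℕ} (G : Graph n) (irr : Subset n) → IsIRChoice G irr →
           PFree G 9 → Chordal G →
           ∀ (A : Subset n) → InDRN G irr A →
           ∀ (I : Subset n) → I ⊆ irr →
           (MinDom G (A ∪ I) ⇔
             (∀ (C : Subset n) → IsIRComponent G irr C → MinCond G irr A C (I ∩ C)))
theorem9 G irr choice p9 chordal A A∈DRN I I⊆irr =
  mk⇔ forward Backward.backward
  where open Extension G irr choice p9 chordal A A∈DRN I I⊆irr
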